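{- Let $E$ be a finite set and let $\mathcal{O}\subseteq\{+,-,0\}^E$ satisfy (O3): $X,Y\in\mathcal{O}\Rightarrow X\circ Y\in\mathcal{O}$. Then $\mathcal{O}$ satisfies (SE): for all $X,Y\in\mathcal{O}$ and $e\in S(X,Y)$ there exists $Z\in\mathcal{O}$ with $Z_e=0$ and $Z_f=(X\circ Y)_f=(Y\circ X)_f$ for all $f\notin S(X,Y)$, if and only if it satisfies (O4): for all $X,Y\in\mathcal{O}$ with $\underline{X}=\underline{Y}$ and $e\in S(X,Y)$ there exists $Z\in\mathcal{O}$ with $Z_e=0$ and $Z_f=(X\circ Y)_f=(Y\circ X)_f$ for all $f\notin S(X,Y)$.
   Context: A sign vector on a finite set $E$ is $X\in\{+,-,0\}^E$ with support $\underline{X}=\{e: X_e\neq0\}$. Composition: $(X\circ Y)_e=X_e$ if $X_e\neq0$, else $Y_e$. Separation set: $S(X,Y)=\{e: X_e,Y_e\neq0,\ X_e\neq Y_e\}$. -}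

module Defs where

open import Data.Nat using (ℕ)
open import Data.Fin using (Fin)
open import Data.Product using (_×_; Σ)
open import Relation.Binary.PropositionalEquality using (_≡_)
open import Relation.Nullary using (¬_)
open import Level using (Level; suc; _⊔_)

data Sign : Set where
  ⊕ ⊖ 𝟘 : Sign

SignVec : ℕ → Set
SignVec n = Fin n → Sign

_∘ₛ_ : ∀ {n} → SignVec n → SignVec n → SignVec n
(X ∘ₛ Y) e with X e
... | 𝟘 = Y e
... | s = s

_∈supp_ : ∀ {n} → Fin n → SignVec n → Set
e ∈supp X = ¬ (X e ≡ 𝟘)

SameSupport : ∀ {n} → SignVec n → SignVec n → Set
SameSupport X Y = ∀ e → (e ∈supp X → e ∈supp Y) × (e ∈supp Y → e ∈supp X)

_∈Sep[_,_] : ∀ {n} → Fin n → SignVec n → SignVec n → Set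
e ∈Sep[ X , Y ] = e ∈supp X × e ∈supp Y × ¬ (X e ≡ Y e)

SignSet : ∀ ℓ → ℕ → Set (suc ℓ)
SignSet ℓ n = SignVec n → Set ℓ

O3 : ∀ {ℓ n} → SignSet ℓ n → Set ℓ
O3 𝒪 = ∀ X Y → 𝒪 X → 𝒪 Y → 𝒪 (X ∘ₛ Y)

Elim : ∀ {ℓ n} → SignSet ℓ n → SignVec n → SignVec n → Fin n → Set ℓ
Elim 𝒪 X Y e = Σ _ λ Z → 𝒪 Z × Z e ≡ 𝟘 ×
  (∀ f → ¬ (f ∈Sep[ X , Y ]) → (Z f ≡ (X ∘ₛ Y) f) × (Z f ≡ (Y ∘ₛ X) f))

SE : ∀ {ℓ n} → SignSet ℓ n → Set ℓ
SE 𝒪 = ∀ X Y → 𝒪 X → 𝒪 Y → ∀ e → e ∈Sep[ X , Y ] → Elim 𝒪 X Y e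

O4 : ∀ {ℓ n} → SignSet ℓ n → Set ℓ
O4 𝒪 = ∀ X Y → 𝒪 X → 𝒪 Y → SameSupport X Y →
  ∀ e → e ∈Sep[ X , Y ] → Elim 𝒪 X Y e

-- The elimination axiom for arbitrary X, Y reduces to the one for X ∘ Y and Y ∘ X, which
-- lie in 𝒪 by (O3) and always have equal supports. The passage loses nothing: X ∘ Y and
-- Y ∘ X separate exactly where X and Y do, and (X ∘ Y) ∘ (Y ∘ X) = X ∘ Y.
module Submission where

open import Defs
open import Data.Nat using (ℕ)
open import Data.Fin using (Fin)
open import Data.Product using (_×_; _,_)
open import Level using (Level)
open import Relation.Binary.PropositionalEquality using (_≡_; refl; sym; trans; subst₂)
open import Relation.Nullary using (¬_; contradiction)

_·_ : Sign → Sign → Sign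
𝟘 · b = b
a · _ = a

-- f ∈Sep[ X , Y ] unfolds to Separated (X f) (Y f).
Separated : Sign → Sign → Set
Separated a b = ¬ (a ≡ 𝟘) × ¬ (b ≡ 𝟘) × ¬ (a ≡ b)

·-absorbs-flip : ∀ a b → (a · b) · (b · a) ≡ a · b
·-absorbs-flip ⊕ _ = refl
·-absorbs-flip ⊖ _ = refl
·-absorbs-flip 𝟘 ⊕ = refl
·-absorbs-flip 𝟘 ⊖ = refl
·-absorbs-flip 𝟘 𝟘 = refl

·-zero-flip : ∀ a b → a · b ≡ 𝟘 → b · a ≡ 𝟘
·-zero-flip 𝟘 𝟘 _ = refl
·-zero-flip ⊕ _ ()
·-zero-flip ⊖ _ ()
·-zero-flip 𝟘 ⊕ ()
·-zero-flip 𝟘 ⊖ ()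

Separated-·⁺ : ∀ a b → Separated a b → Separated (a · b) (b · a)
Separated-·⁺ ⊕ ⊖ sep = sep
Separated-·⁺ ⊖ ⊕ sep = sep
Separated-·⁺ ⊕ ⊕ (_ , _ , a≢b) = contradiction refl a≢b
Separated-·⁺ ⊖ ⊖ (_ , _ , a≢b) = contradiction refl a≢b
Separated-·⁺ _ 𝟘 (_ , b≢0 , _) = contradiction refl b≢0
Separated-·⁺ 𝟘 _ (a≢0 , _ , _) = contradiction refl a≢0

Separated-·⁻ : ∀ a b → Separated (a · b) (b · a) → Separated a b
Separated-·⁻ ⊕ ⊖ sep = sep
Separated-·⁻ ⊖ ⊕ sep = sep
Separated-·⁻ ⊕ ⊕ (_ , _ , ab≢ba) = contradiction refl ab≢ba
Separated-·⁻ ⊖ ⊖ (_ , _ , ab≢ba) = contradiction refl ab≢ba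
Separated-·⁻ ⊕ 𝟘 (_ , _ , ab≢ba) = contradiction refl ab≢ba
Separated-·⁻ ⊖ 𝟘 (_ , _ , ab≢ba) = contradiction refl ab≢ba
Separated-·⁻ 𝟘 ⊕ (_ , _ , ab≢ba) = contradiction refl ab≢ba
Separated-·⁻ 𝟘 ⊖ (_ , _ , ab≢ba) = contradiction refl ab≢ba
Separated-·⁻ 𝟘 𝟘 (_ , _ , ab≢ba) = contradiction refl ab≢ba

∘ₛ-pointwise : ∀ {n} (X Y : SignVec n) f → (X ∘ₛ Y) f ≡ X f · Y f
∘ₛ-pointwise X Y f with X f
... | ⊕ = refl
... | ⊖ = refl
... | 𝟘 = refl

module _ {n : ℕ} (X Y : SignVec n) (f : Fin n) where

  ∘ₛ-absorbs-flip : ((X ∘ₛ Y) ∘ₛ (Y ∘ₛ X)) f ≡ (X ∘ₛ Y) f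
  ∘ₛ-absorbs-flip
    rewrite ∘ₛ-pointwise (X ∘ₛ Y) (Y ∘ₛ X) f | ∘ₛ-pointwise X Y f | ∘ₛ-pointwise Y X f
    = ·-absorbs-flip (X f) (Y f)

  ∘ₛ-zero-flip : (X ∘ₛ Y) f ≡ 𝟘 → (Y ∘ₛ X) f ≡ 𝟘
  ∘ₛ-zero-flip XYf≡0 =
    trans (∘ₛ-pointwise Y X f) (·-zero-flip (X f) (Y f) (trans (sym (∘ₛ-pointwise X Y f)) XYf≡0))

  ∈Sep-∘ₛ⁺ : f ∈Sep[ X , Y ] → f ∈Sep[ X ∘ₛ Y , Y ∘ₛ X ]
  ∈Sep-∘ₛ⁺ f∈S = subst₂ Separated (sym (∘ₛ-pointwise X Y f)) (sym (∘ₛ-pointwise Y X f))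
                   (Separated-·⁺ (X f) (Y f) f∈S)

  ∈Sep-∘ₛ⁻ : f ∈Sep[ X ∘ₛ Y , Y ∘ₛ X ] → f ∈Sep[ X , Y ]
  ∈Sep-∘ₛ⁻ f∈S = Separated-·⁻ (X f) (Y f)
                   (subst₂ Separated (∘ₛ-pointwise X Y f) (∘ₛ-pointwise Y X f) f∈S)

∘ₛ-sameSupport-flip : ∀ {n} (X Y : SignVec n) → SameSupport (X ∘ₛ Y) (Y ∘ₛ X)
∘ₛ-sameSupport-flip X Y f =
  (λ XYf≢0 YXf≡0 → XYf≢0 (∘ₛ-zero-flip Y X f YXf≡0)) ,
  (λ YXf≢0 XYf≡0 → YXf≢0 (∘ₛ-zero-flip X Y f XYf≡0))

Elim-from-∘ₛ : ∀ {ℓ n} (𝒪 : SignSet ℓ n) (X Y : SignVec n) (e : Fin n) →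
  Elim 𝒪 (X ∘ₛ Y) (Y ∘ₛ X) e → Elim 𝒪 X Y e
Elim-from-∘ₛ 𝒪 X Y e (Z , Z∈𝒪 , Zₑ≡0 , agree) = Z , Z∈𝒪 , Zₑ≡0 , agree′
  where
  agree′ : ∀ f → ¬ (f ∈Sep[ X , Y ]) → (Z f ≡ (X ∘ₛ Y) f) × (Z f ≡ (Y ∘ₛ X) f)
  agree′ f f∉S with agree f (λ f∈S′ → f∉S (∈Sep-∘ₛ⁻ X Y f f∈S′))
  ... | Zf≡XYf , Zf≡YXf = trans Zf≡XYf (∘ₛ-absorbs-flip X Y f)
                        , trans Zf≡YXf (∘ₛ-absorbs-flip Y X f)

lemma5p1 : ∀ {ℓ : Level} (n : ℕ) (𝒪 : SignSet ℓ n) → O3 𝒪 →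
    (SE 𝒪 → O4 𝒪) × (O4 𝒪 → SE 𝒪)
lemma5p1 n 𝒪 o3 = (λ se X Y X∈𝒪 Y∈𝒪 _ → se X Y X∈𝒪 Y∈𝒪) , O4⇒SE
  where
  O4⇒SE : O4 𝒪 → SE 𝒪
  O4⇒SE o4 X Y X∈𝒪 Y∈𝒪 e e∈S =
    Elim-from-∘ₛ 𝒪 X Y e
      (o4 (X ∘ₛ Y) (Y ∘ₛ X) (o3 X Y X∈𝒪 Y∈𝒪) (o3 Y X Y∈𝒪 X∈𝒪)
          (∘ₛ-sameSupport-flip X Y) e (∈Sep-∘ₛ⁺ X Y e e∈S))
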